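{- Let $G$ and $H$ be two connected nontrivial graphs. Let $v,x,y$ be vertices of $H$ such that $x\ne v$ and $y\ne v$. Then for every vertex $a$ of $G$, the vertices $(a,x)$ and $(a,y)$ are mutually maximally distant in $G\circ_v H$ if and only if $x$ and $y$ are mutually maximally distant in $H$.
   Context: All graphs are finite and simple; $d_G$ denotes the shortest-path distance in a connected graph $G$ and $N_G(u)$ the set of neighbours of $u$. A vertex $u$ is maximally distant from a vertex $w$ in $G$ if for every $z\in N_G(u)$ we have $d_G(w,z)\le d_G(u,w)$. Two vertices $u,w$ are mutually maximally distant if each is maximally distant from the other. Rooted product: given a graph $G$ with $V(G)=\{u_1,\dots,u_n\}$ and a graph $H$ with a distinguished root vertex $v$, the graph $G\circ_v H$ has vertex set $V(G)\times V(H)$ and edge set $\bigcup_{i=1}^n\{(u_i,b)(u_i,y): by\in E(H)\}\cup\{(u_i,v)(u_j,v): u_iu_j\in E(G)\}$. -}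

module Defs where

open import Data.Nat using (ℕ; zero; suc; _≤_; _*_)
open import Data.Fin using (Fin)
open import Data.Fin.Properties using (*↔×)
open import Data.Product using (Σ; ∃; _×_; _,_; proj₁; proj₂)
open import Data.Sum using (_⊎_; inj₁; inj₂)
open import Data.Empty using (⊥)
open import Relation.Nullary using (¬_)
open import Relation.Binary.PropositionalEquality using (_≡_; refl)
open import Function.Bundles using (_↔_)
open import Function.Properties.Inverse using (↔-sym; ↔-trans)
open import Data.Product.Function.NonDependent.Propositional using (_×-↔_)

record Graph : Set₁ where
  field
    V     : Set
    size  : ℕ
    enum  : V ↔ Fin size
    Adj   : V → V → Set
    adj-sym : ∀ {u w} → Adj u w → Adj w u
    irrefl : ∀ {u} → ¬ Adj u u

open Graph public

data Walk (G : Graph) : V G → V G → ℕ → Set where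
  nil  : ∀ u → Walk G u u zero
  cons : ∀ {u z w k} → Adj G u z → Walk G z w k → Walk G u w (suc k)

Connected : Graph → Set
Connected G = ∀ u w → ∃ λ k → Walk G u w k

Nontrivial : Graph → Set
Nontrivial G = 2 ≤ size G

Dist : (G : Graph) → V G → V G → ℕ → Set
Dist G u w k = Walk G u w k × (∀ j → Walk G u w j → k ≤ j)

MaxDistFrom : (G : Graph) → V G → V G → Set
MaxDistFrom G u w =
  ∀ z → Adj G u z → ∀ m n → Dist G w z m → Dist G u w n → m ≤ n

MutuallyMaxDist : (G : Graph) → V G → V G → Set
MutuallyMaxDist G u w = MaxDistFrom G u w × MaxDistFrom G w u

RPAdj : (G H : Graph) → V H → (V G × V H) → (V G × V H) → Set
RPAdj G H v (a , b) (a' , y) =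
  (a ≡ a' × Adj H b y) ⊎ (b ≡ v × y ≡ v × Adj G a a')

private
  rp-sym : ∀ G H v {p q} → RPAdj G H v p q → RPAdj G H v q p
  rp-sym G H v (inj₁ (refl , e)) = inj₁ (refl , Graph.adj-sym H e)
  rp-sym G H v (inj₂ (e1 , e2 , e)) = inj₂ (e2 , e1 , Graph.adj-sym G e)

  rp-irrefl : ∀ G H v {p} → ¬ RPAdj G H v p p
  rp-irrefl G H v (inj₁ (_ , e)) = Graph.irrefl H e
  rp-irrefl G H v (inj₂ (_ , _ , e)) = Graph.irrefl G e

RootedProduct : (G H : Graph) → V H → Graph
RootedProduct G H v = record
  { V = V G × V H
  ; size = size G * size H
  ; enum = ↔-trans (enum G ×-↔ enum H) (↔-sym *↔×)
  ; Adj = RPAdj G H v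
  ; adj-sym = rp-sym G H v
  ; irrefl = rp-irrefl G H v
  }

module Submission where

open import Defs
open import Data.Product using (_×_; _,_; proj₂; ∃)
open import Relation.Nullary using (¬_)
open import Relation.Binary.PropositionalEquality using (_≡_; refl; trans; sym; subst)
open import Function.Bundles using (_⇔_; mk⇔)
open import Data.Nat using (suc; _≤_; z≤n; s≤s)
open import Data.Nat.Properties using (≤-trans; m≤n⇒m≤1+n; ≤-antisym)
open import Data.Sum using (inj₁; inj₂)
open import Data.Empty using (⊥-elim)

-- Projecting to H shows that a shortest walk between two vertices of one copy of H never
-- leaves it, so distances inside a copy are those of H; and a vertex off the root has all
-- its neighbours in its own copy, so for it maximal distance in the product is maximal
-- distance in H.

module _ (G H : Graph) (v : V H) where

  private
    P : Graph
    P = RootedProduct G H v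

  -- A G-edge joins two copies of the root, so its projection is a repeated vertex and is dropped.
  project-walk : ∀ {p q k} → Walk P p q k → ∃ λ j → j ≤ k × Walk H (proj₂ p) (proj₂ q) j
  project-walk (nil _) = 0 , z≤n , nil _
  project-walk (cons (inj₁ (_ , e)) w) with project-walk w
  ... | j , j≤k , w′ = suc j , s≤s j≤k , cons e w′
  project-walk (cons (inj₂ (b≡v , c≡v , _)) w) with project-walk w
  ... | j , j≤k , w′ = j , m≤n⇒m≤1+n j≤k , subst (λ t → Walk H t _ j) (trans c≡v (sym b≡v)) w′

  lift-walk : ∀ a {b c k} → Walk H b c k → Walk P (a , b) (a , c) k
  lift-walk a (nil _) = nil _
  lift-walk a (cons e w) = cons (inj₁ (refl , e)) (lift-walk a w)

  dist-lift : ∀ a {b c m} → Dist H b c m → Dist P (a , b) (a , c) m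
  dist-lift a (w , minimal) = lift-walk a w , λ j w′ →
    let (j′ , j′≤j , w″) = project-walk w′ in ≤-trans (minimal j′ w″) j′≤j

  dist-project : ∀ a {b c m} → Dist P (a , b) (a , c) m → Dist H b c m
  dist-project a {m = m} (w , minimal) with project-walk w
  ... | j , j≤m , w′ = subst (Walk H _ _) (≤-antisym j≤m (minimal j (lift-walk a w′))) w′
                     , λ j′ w″ → minimal j′ (lift-walk a w″)

  maxDistFrom-project : ∀ a {x y} → MaxDistFrom P (a , x) (a , y) → MaxDistFrom H x y
  maxDistFrom-project a md z e m n dm dn =
    md (a , z) (inj₁ (refl , e)) m n (dist-lift a dm) (dist-lift a dn)

  maxDistFrom-lift : ∀ a {x y} → ¬ (x ≡ v) → MaxDistFrom H x y → MaxDistFrom P (a , x) (a , y)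
  maxDistFrom-lift a x≢v md (_ , z) (inj₁ (refl , e)) m n dm dn =
    md z e m n (dist-project a dm) (dist-project a dn)
  maxDistFrom-lift a x≢v md _ (inj₂ (x≡v , _)) = ⊥-elim (x≢v x≡v)

lemma3 : (G H : Graph) → Connected G → Nontrivial G → Connected H → Nontrivial H →
    (v x y : V H) → ¬ (x ≡ v) → ¬ (y ≡ v) → (a : V G) →
    MutuallyMaxDist (RootedProduct G H v) (a , x) (a , y) ⇔ MutuallyMaxDist H x y
lemma3 G H _ _ _ _ v x y x≢v y≢v a = mk⇔
  (λ (xy , yx) → maxDistFrom-project G H v a xy , maxDistFrom-project G H v a yx)
  (λ (xy , yx) → maxDistFrom-lift G H v a x≢v xy , maxDistFrom-lift G H v a y≢v yx)
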